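{- For integers $m\ge n\ge 1$, $R(\mathscr{C}(mC_5), nK_2)=5m+n-1$.
   Context: $mC_5$ is the disjoint union of $m$ $5$-cycles and $nK_2$ is a matching of $n$ edges. $\mathscr{C}(H)$ is the set of connected graphs containing $H$ as a subgraph. For sets of graphs $\mathscr{G}_1,\mathscr{G}_2$ (a single graph being identified with the set containing it), $R(\mathscr{G}_1,\mathscr{G}_2)$ is the minimum $n$ such that every red-blue coloring of the edges of $K_n$ contains either a red copy of a graph in $\mathscr{G}_1$ or a blue copy of a graph in $\mathscr{G}_2$. -}

module Defs where

open import Level using (Level; 0ℓ; Lift) renaming (suc to lsuc)
open import Data.Nat using (ℕ; _+_; _*_; _∸_; _<_; _%_)
open import Data.Fin using (Fin; toℕ)
open import Data.Product using (Σ; _×_; _,_)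
open import Data.Sum using (_⊎_)
open import Relation.Binary.PropositionalEquality using (_≡_; _≢_)
open import Relation.Nullary using (¬_)
open import Function.Definitions using (Injective; Bijective)

record Graph : Set₁ where
  field
    V   : Set
    Adj : V → V → Set
open Graph public

Embeds : Graph → Graph → Set
Embeds H G = Σ (V H → V G) λ f → Injective _≡_ _≡_ f × (∀ u v → Adj H u v → Adj G (f u) (f v))

Iso : Graph → Graph → Set
Iso H G = Σ (V H → V G) λ f → Bijective _≡_ _≡_ f × (∀ u v → (Adj H u v → Adj G (f u) (f v)) × (Adj G (f u) (f v) → Adj H u v))

data Walk (G : Graph) : V G → V G → Set where
  here : ∀ {u} → Walk G u u
  step : ∀ {u w v} → Adj G u w → Walk G w v → Walk G u v

Connected : Graph → Set
Connected G = ∀ u v → Walk G u v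

mC5 : ℕ → Graph
mC5 m = record
  { V   = Fin m × Fin 5
  ; Adj = λ { (i , a) (j , b) → i ≡ j × (toℕ b ≡ (toℕ a + 1) % 5 ⊎ toℕ a ≡ (toℕ b + 1) % 5) } }

nK2 : ℕ → Graph
nK2 n = record
  { V   = Fin n × Fin 2
  ; Adj = λ { (i , a) (j , b) → i ≡ j × a ≢ b } }

-- A family of graphs (a single graph H is identified with {H} via Single)
Family : Set₁
Family = Graph → Set

Single : Graph → Family
Single H G = Iso H G

𝒞 : Graph → Family
𝒞 H G = Connected G × Embeds H G

data Colour : Set where
  red blue : Colour

record Colouring (N : ℕ) : Set where
  field
    col : Fin N → Fin N → Colour
    sym : ∀ i j → col i j ≡ col j i
open Colouring public

ColourGraph : ∀ {N} → Colour → Colouring N → Graph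
ColourGraph {N} k c = record { V = Fin N ; Adj = λ i j → i ≢ j × col c i j ≡ k }

HasCopy : ∀ {N} → Colour → Family → Colouring N → Set₁
HasCopy k F c = Σ Graph λ G → F G × Embeds G (ColourGraph k c)

Arrows : ℕ → Family → Family → Set₁
Arrows N F₁ F₂ = (c : Colouring N) → HasCopy red F₁ c ⊎ HasCopy blue F₂ c

RamseyIs : Family → Family → ℕ → Set₁
RamseyIs F₁ F₂ r = Arrows r F₁ F₂ × (∀ N → N < r → ¬ Arrows N F₁ F₂)

module Submission where

-- On N < 5m + n − 1 vertices call the first n − 1 vertices
-- special and colour an edge blue exactly when it meets a special vertex.
-- Every vertex of a red 5-cycle lies on a red edge, hence is not special,
-- and fewer than 5m vertices are not special; every blue edge meets one of
-- the n − 1 special vertices, so there is no blue nK₂.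
--
-- On N = 5m + n − 1 vertices grow a blue matching M greedily,
-- keeping the unmatched vertices in a list U, by two moves: add a blue edge
-- inside U, or replace a matching edge ab by au, bw for distinct u, w ∈ U
-- with au, bw blue.  Each move adds an edge, so after at most n moves either
-- M is a blue nK₂ or, with k = |M| < n, no move applies.  Then U is a red
-- clique and every matching edge has an end with at most one blue neighbour
-- in U.  These k ends together with m − k vertices of U are the centres of
-- m red pentagons whose other corners are 4m further vertices of U
-- ('Pentagons'); the red clique makes their union connected.

open import Defs hiding (sym)
open import Data.Bool using (Bool; true; false; _∨_; if_then_else_)
open import Data.Bool.Properties using (∨-comm)
open import Data.Empty using (⊥)
open import Data.Fin using (Fin; zero; suc; toℕ; fromℕ<; inject≤; combine)
open import Data.Fin.Patterns using (0F; 1F; 2F; 3F; 4F)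
open import Data.Fin.Properties
  using (toℕ-injective; toℕ<n; toℕ-fromℕ<; fromℕ<-injective; injective⇒≤; inject≤-injective; combine-injective; *↔×; _≟_)
open import Data.List using (List; []; _∷_; _++_; length; lookup; take; drop; allFin)
open import Data.List.Properties
  using (length-++; length-take; length-drop; length-tabulate; take++drop≡id; ++-assoc)
open import Data.List.Membership.Propositional using (_∈_; find; lose)
open import Data.List.Membership.Propositional.Properties using (∈-∃++; ∈-lookup; ∈-++⁺ˡ; ∈-++⁺ʳ)
open import Data.List.Relation.Unary.All as All using (All; []; _∷_)
open import Data.List.Relation.Unary.All.Properties as AllP using ()
open import Data.List.Relation.Unary.Any using (Any; here; there; any?)
open import Data.List.Relation.Unary.AllPairs using (_∷_)
open import Data.List.Relation.Unary.Unique.Propositional using (Unique)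
open import Data.List.Relation.Unary.Unique.Propositional.Properties using (allFin⁺)
open import Data.List.Relation.Binary.Permutation.Propositional
  using (_↭_; ↭-sym; prep; swap; ↭⇒↭ₛ) renaming (refl to ↭-refl; trans to ↭-trans)
open import Data.List.Relation.Binary.Permutation.Propositional.Properties as Perm
  using (shift; shifts; ↭-length; ∈-resp-↭; All-resp-↭)
import Data.List.Relation.Binary.Permutation.Setoid.Properties as PermSetoid
open import Data.List.Relation.Binary.Sublist.Propositional using (_⊆_; []; _∷_; _∷ʳ_; ⊆-refl)
open import Data.List.Relation.Binary.Sublist.Propositional.Properties as Sub
  using (All-resp-⊆; Any-resp-⊆; drop-⊆)
open import Data.Nat using (ℕ; zero; suc; _≤_; _<_; _+_; _*_; _∸_; z≤n; s≤s; _<ᵇ_)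
open import Data.Nat.DivMod using (m%n<n)
open import Data.Nat.Properties
  using ( <ᵇ-reflects-<; ≤-refl; ≤-trans; <⇒≤; <⇒≱; ≮⇒≥; +-comm; +-suc; *-comm; +-identityʳ; +-monoʳ-≤
        ; +-cancelʳ-≤; ∸-monoˡ-<; ∸-cancelʳ-≡; m∸n+n≡m; m≤n+m∸n; m<n+o⇒m∸n<o
        ; m+n≤o⇒n≤o; m+n≤o⇒m≤o∸n; m≤n⇒m⊓n≡m; m<m+n; module ≤-Reasoning)
open import Data.Nat.Solver using (module +-*-Solver)
open import Data.Product using (Σ; ∃; _×_; _,_; proj₁; proj₂; map₁)
open import Data.Sum using (_⊎_; inj₁; inj₂; [_,_]′)
open import Function using (id; _∘_)
open import Function.Bundles using (Inverse; Injection)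
open import Function.Properties.Inverse using (↔⇒↣)
open import Function.Definitions using (Injective)
open import Relation.Binary.PropositionalEquality
  using (_≡_; _≢_; refl; sym; trans; cong; cong₂; subst; subst₂; setoid; module ≡-Reasoning)
open import Relation.Nullary using (¬_; Dec; yes; no; contradiction)
open import Relation.Nullary.Reflects using (ofʸ; ofⁿ)
open import Relation.Nullary.Decidable using (_×-dec_; _⊎-dec_; ¬?)

notBlue⇒red : ∀ {k} → k ≢ blue → k ≡ red
notBlue⇒red {red}  _      = refl
notBlue⇒red {blue} k≢blue = contradiction refl k≢blue

_≟ᶜ_ : (a b : Colour) → Dec (a ≡ b)
red  ≟ᶜ red  = yes refl
red  ≟ᶜ blue = no λ ()
blue ≟ᶜ red  = no λ ()
blue ≟ᶜ blue = yes refl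

_++ʷ_ : ∀ {G u v w} → Walk G u v → Walk G v w → Walk G u w
here       ++ʷ q = q
step e p   ++ʷ q = step e (p ++ʷ q)

reverseʷ : ∀ {G} → (∀ {u v} → Adj G u v → Adj G v u) → ∀ {u v} → Walk G u v → Walk G v u
reverseʷ reverse-edge here       = here
reverseʷ reverse-edge (step e p) = reverseʷ reverse-edge p ++ʷ step (reverse-edge e) here

window-pigeonhole : ∀ {a N} lo hi (f : Fin a → Fin N) → Injective _≡_ _≡_ f →
                    (∀ i → lo ≤ toℕ (f i)) → (∀ i → toℕ (f i) < hi) → a ≤ hi ∸ lo
window-pigeonhole {a} lo hi f f-inj above below = injective⇒≤ {f = offset} offset-inj
  where
  offset : Fin a → Fin (hi ∸ lo)
  offset i = fromℕ< (∸-monoˡ-< (below i) (above i))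

  offset-inj : Injective _≡_ _≡_ offset
  offset-inj {i} {j} eq =
    f-inj (toℕ-injective (∸-cancelʳ-≡ (above i) (above j) (fromℕ<-injective _ _ _ _ eq)))

next : Fin 5 → Fin 5
next a = fromℕ< (m%n<n (toℕ a + 1) 5)

next≢ : ∀ a → a ≢ next a
next≢ 0F ()
next≢ 1F ()
next≢ 2F ()
next≢ 3F ()
next≢ 4F ()

cycle-edge : ∀ {m} (i : Fin m) a → Adj (mC5 m) (i , a) (i , next a)
cycle-edge i a = refl , inj₁ (toℕ-fromℕ< _)

cycle-edge⁻ : ∀ {m} {i j : Fin m} {a b} → Adj (mC5 m) (i , a) (j , b) →
              i ≡ j × (b ≡ next a ⊎ a ≡ next b)
cycle-edge⁻ (i≡j , inj₁ b≡a+1) = i≡j , inj₁ (toℕ-injective (trans b≡a+1 (sym (toℕ-fromℕ< _))))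
cycle-edge⁻ (i≡j , inj₂ a≡b+1) = i≡j , inj₂ (toℕ-injective (trans a≡b+1 (sym (toℕ-fromℕ< _))))

special : ∀ {N} → ℕ → Fin N → Bool
special s i = toℕ i <ᵇ s

blueIf : Bool → Colour
blueIf b = if b then blue else red

splitColouring : ∀ N → ℕ → Colouring N
splitColouring N s = record
  { col = λ i j → blueIf (special s i ∨ special s j)
  ; sym = λ i j → cong blueIf (∨-comm (special s i) (special s j))
  }

red⇒ordinary : ∀ {N} s (i j : Fin N) → col (splitColouring N s) i j ≡ red → s ≤ toℕ i
red⇒ordinary s i j ij-red with toℕ i <ᵇ s | <ᵇ-reflects-< (toℕ i) s
... | true  | _        = contradiction ij-red λ ()
... | false | ofⁿ i≮s = ≮⇒≥ i≮s

blue⇒special : ∀ {N} s (i j : Fin N) → col (splitColouring N s) i j ≡ blue →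
               toℕ i < s ⊎ toℕ j < s
blue⇒special s i j ij-blue
  with toℕ i <ᵇ s | <ᵇ-reflects-< (toℕ i) s | toℕ j <ᵇ s | <ᵇ-reflects-< (toℕ j) s
... | true  | ofʸ i<s | _     | _        = inj₁ i<s
... | false | _        | true  | ofʸ j<s = inj₂ j<s
... | false | _        | false | _        = contradiction ij-blue λ ()

-- A red graph containing mC₅ would place its 5m cycle vertices, each on a
-- red edge, injectively on the N ∸ s vertices that are not special.
noRedCycles : ∀ {N} s m → N ∸ s < m * 5 → ¬ HasCopy red (𝒞 (mC5 m)) (splitColouring N s)
noRedCycles {N} s m few (_ , (_ , e , e-inj , e-adj) , f , f-inj , f-adj) =
  <⇒≱ few (window-pigeonhole s N place place-inj (λ _ → on-cycle-ordinary _) (λ k → toℕ<n (place k)))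
  where
  on-cycle-ordinary : ∀ x → s ≤ toℕ (f (e x))
  on-cycle-ordinary (i , a) = red⇒ordinary s _ _ (proj₂ (f-adj _ _ (e-adj _ _ (cycle-edge i a))))

  place : Fin (m * 5) → Fin N
  place k = f (e (Inverse.to *↔× k))

  place-inj : Injective _≡_ _≡_ place
  place-inj eq = Injection.injective (↔⇒↣ *↔×) (e-inj (f-inj eq))

-- Each edge of a blue nK₂ meets a special vertex, and distinct edges meet
-- distinct ones, so a blue nK₂ needs n ≤ s.
noBlueMatching : ∀ {N} s n → s < n → ¬ HasCopy blue (Single (nK2 n)) (splitColouring N s)
noBlueMatching {N} s n s<n (_ , (φ , φ-bij , φ-adj) , f , f-inj , f-adj) =
  <⇒≱ s<n (window-pigeonhole 0 s specialEnd specialEnd-inj (λ _ → z≤n) (λ i → proj₂ (specialSide i)))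
  where
  g : Fin n × Fin 2 → Fin N
  g x = f (φ x)

  specialSide : ∀ i → Σ (Fin 2) λ t → toℕ (g (i , t)) < s
  specialSide i = [ (0F ,_) , (1F ,_) ]′
    (blue⇒special s _ _ (proj₂ (f-adj _ _ (proj₁ (φ-adj (i , 0F) (i , 1F)) (refl , λ ())))))

  specialEnd : Fin n → Fin N
  specialEnd i = g (i , proj₁ (specialSide i))

  specialEnd-inj : Injective _≡_ _≡_ specialEnd
  specialEnd-inj eq = cong proj₁ (proj₁ φ-bij (f-inj eq))

-- The Ramsey number 5m + n − 1, written with n = s + 1 as s + 5m.
bound-split : ∀ m s → 5 * m + suc s ∸ 1 ≡ s + m * 5
bound-split m s = begin
  5 * m + suc s ∸ 1  ≡⟨ cong (_∸ 1) (+-suc (5 * m) s) ⟩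
  5 * m + s          ≡⟨ +-comm (5 * m) s ⟩
  s + 5 * m          ≡⟨ cong (s +_) (*-comm 5 m) ⟩
  s + m * 5          ∎
  where open ≡-Reasoning

lowerBound : ∀ m n → 1 ≤ n → n ≤ m → ∀ N → N < 5 * m + n ∸ 1 → ¬ Arrows N (𝒞 (mC5 m)) (Single (nK2 n))
lowerBound zero    (suc s) _ () _
lowerBound (suc m) (suc s) _ _  N N<bound arrows with arrows (splitColouring N s)
... | inj₁ redCopy  = noRedCycles s (suc m) (m<n+o⇒m∸n<o N s (subst (N <_) (bound-split (suc m) s) N<bound)) redCopy
... | inj₂ blueCopy = noBlueMatching s (suc s) ≤-refl blueCopy

blueMatchingCopy : ∀ {N} (c : Colouring N) n (g : Fin n × Fin 2 → Fin N) → Injective _≡_ _≡_ g →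
                   (∀ i → col c (g (i , 0F)) (g (i , 1F)) ≡ blue) → HasCopy blue (Single (nK2 n)) c
blueMatchingCopy c n g g-inj edges-blue = nK2 n , nK2-self , g , g-inj , g-adj
  where
  nK2-self : Iso (nK2 n) (nK2 n)
  nK2-self = id , (id , λ y → y , id) , λ _ _ → id , id

  edge-blue : ∀ i a b → a ≢ b → col c (g (i , a)) (g (i , b)) ≡ blue
  edge-blue i 0F 0F a≢b = contradiction refl a≢b
  edge-blue i 0F 1F _   = edges-blue i
  edge-blue i 1F 0F _   = trans (Colouring.sym c _ _) (edges-blue i)
  edge-blue i 1F 1F a≢b = contradiction refl a≢b

  g-adj : ∀ u v → Adj (nK2 n) u v → Adj (ColourGraph blue c) (g u) (g v)
  g-adj (i , a) (.i , b) (refl , a≢b) = (a≢b ∘ cong proj₂ ∘ g-inj) , edge-blue i a b a≢b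

-- Pentagon i has the centre 'centre i' and the rim
-- vertices 'rim (i , t)', t < 4.  If the rim vertices are pairwise joined in
-- red and every centre has at most one blue neighbour on its own rim, then
-- each pentagon can be traversed along red edges, and the rim connects the
-- pentagons: a red copy of a connected graph containing mC₅.
module Pentagons {N} (c : Colouring N) (m : ℕ)
  (centre : Fin m → Fin N) (rim : Fin m × Fin 4 → Fin N)
  (centre-inj : Injective _≡_ _≡_ centre) (rim-inj : Injective _≡_ _≡_ rim)
  (centre≢rim : ∀ i r → centre i ≢ rim r)
  (rim-red : ∀ r r′ → r ≢ r′ → col c (rim r) (rim r′) ≡ red)
  (centre-good : ∀ i t t′ → t ≢ t′ → col c (centre i) (rim (i , t)) ≡ blue →
                 col c (centre i) (rim (i , t′)) ≡ blue → ⊥)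
  where

  slot : Fin m → Fin 5 → Fin N
  slot i zero    = centre i
  slot i (suc t) = rim (i , t)

  slot-injective : ∀ {i j a b} → slot i a ≡ slot j b → i ≡ j × a ≡ b
  slot-injective {i} {j} {zero}  {zero}  eq = centre-inj eq , refl
  slot-injective {i} {j} {zero}  {suc t} eq = contradiction eq (centre≢rim i _)
  slot-injective {i} {j} {suc s} {zero}  eq = contradiction (sym eq) (centre≢rim j _)
  slot-injective {i} {j} {suc s} {suc t} eq with rim-inj eq
  ... | refl = refl , refl

  twist : Fin 5 → Fin 5
  twist 0F = 0F
  twist 1F = 2F
  twist 2F = 1F
  twist 3F = 4F
  twist 4F = 3F

  twist-involutive : ∀ a → twist (twist a) ≡ a
  twist-involutive 0F = refl
  twist-involutive 1F = refl
  twist-involutive 2F = refl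
  twist-involutive 3F = refl
  twist-involutive 4F = refl

  -- Pentagon i is traversed in slot order 0 1 2 3 4, unless its centre is
  -- blue to rim vertex 0 or 3; then it is traversed in the twisted order
  -- 0 2 1 4 3, whose two centre edges go to rim vertices 1 and 2.
  Twisted : Fin m → Set
  Twisted i = col c (centre i) (rim (i , 0F)) ≡ blue ⊎ col c (centre i) (rim (i , 3F)) ≡ blue

  twisted? : ∀ i → Dec (Twisted i)
  twisted? i = (col c _ _ ≟ᶜ blue) ⊎-dec (col c _ _ ≟ᶜ blue)

  order : ∀ {i} → Dec (Twisted i) → Fin 5 → Fin 5
  order (no  _) a = a
  order (yes _) a = twist a

  order-injective : ∀ {i} (d : Dec (Twisted i)) {a b} → order d a ≡ order d b → a ≡ b
  order-injective (no  _) eq = eq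
  order-injective (yes _) {a} {b} eq = begin
    a               ≡⟨ sym (twist-involutive a) ⟩
    twist (twist a) ≡⟨ cong twist eq ⟩
    twist (twist b) ≡⟨ twist-involutive b ⟩
    b               ∎
    where open ≡-Reasoning

  corner : Fin m × Fin 5 → Fin N
  corner (i , a) = slot i (order (twisted? i) a)

  corner-injective : Injective _≡_ _≡_ corner
  corner-injective {i , a} {j , b} eq with slot-injective {i} {j} {order (twisted? i) a} {order (twisted? j) b} eq
  ... | refl , same-slot = cong (i ,_) (order-injective (twisted? i) same-slot)

  pentagon-red : ∀ i a → col c (corner (i , a)) (corner (i , next a)) ≡ red
  pentagon-red i = sides (twisted? i)
    where
    rim-side : ∀ t t′ → t ≢ t′ → col c (rim (i , t)) (rim (i , t′)) ≡ red
    rim-side t t′ t≢t′ = rim-red _ _ (t≢t′ ∘ cong proj₂)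

    spoke : Twisted i → ∀ t → t ≢ 0F → t ≢ 3F → col c (centre i) (rim (i , t)) ≡ red
    spoke twisted t t≢0 t≢3 = notBlue⇒red λ t-blue →
      [ (λ blue0 → centre-good i 0F t (t≢0 ∘ sym) blue0 t-blue)
      , (λ blue3 → centre-good i 3F t (t≢3 ∘ sym) blue3 t-blue) ]′ twisted

    sides : (d : Dec (Twisted i)) → ∀ a → col c (slot i (order d a)) (slot i (order d (next a))) ≡ red
    sides (no  plain)   0F = notBlue⇒red (plain ∘ inj₁)
    sides (no  _)       1F = rim-side 0F 1F λ ()
    sides (no  _)       2F = rim-side 1F 2F λ ()
    sides (no  _)       3F = rim-side 2F 3F λ ()
    sides (no  plain)   4F = trans (Colouring.sym c _ _) (notBlue⇒red (plain ∘ inj₂))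
    sides (yes twisted) 0F = spoke twisted 1F (λ ()) (λ ())
    sides (yes _)       1F = rim-side 1F 0F λ ()
    sides (yes _)       2F = rim-side 0F 3F λ ()
    sides (yes _)       3F = rim-side 3F 2F λ ()
    sides (yes twisted) 4F = trans (Colouring.sym c _ _) (spoke twisted 2F (λ ()) (λ ()))

  RedCorners : Graph
  RedCorners = record { V = Fin m × Fin 5 ; Adj = λ x y → Adj (ColourGraph red c) (corner x) (corner y) }

  side : ∀ i a → Adj RedCorners (i , a) (i , next a)
  side i a = (next≢ a ∘ cong proj₂ ∘ corner-injective) , pentagon-red i a

  reverse-edge : ∀ {x y} → Adj RedCorners x y → Adj RedCorners y x
  reverse-edge (x≢y , xy-red) = (x≢y ∘ sym) , trans (Colouring.sym c _ _) xy-red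

  cycles-embed : ∀ u v → Adj (mC5 m) u v → Adj RedCorners u v
  cycles-embed (i , a) (j , b) uv with cycle-edge⁻ uv
  ... | refl , inj₁ refl = side i a
  ... | refl , inj₂ refl = reverse-edge (side i b)

  hub-on-rim : ∀ i → Σ (Fin 4) λ t → corner (i , 1F) ≡ rim (i , t)
  hub-on-rim i with twisted? i
  ... | no  _ = 0F , refl
  ... | yes _ = 1F , refl

  hub-edge : ∀ {i j} → i ≢ j → Adj RedCorners (i , 1F) (j , 1F)
  hub-edge {i} {j} i≢j with hub-on-rim i | hub-on-rim j
  ... | _ , hubᵢ | _ , hubⱼ =
    (i≢j ∘ cong proj₁ ∘ corner-injective) ,
    subst₂ (λ x y → col c x y ≡ red) (sym hubᵢ) (sym hubⱼ) (rim-red _ _ (i≢j ∘ cong proj₁))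

  to-hub : ∀ i a → Walk RedCorners (i , a) (i , 1F)
  to-hub i 0F = step (side i 0F) here
  to-hub i 1F = here
  to-hub i 2F = step (reverse-edge (side i 1F)) here
  to-hub i 3F = step (reverse-edge (side i 2F)) (to-hub i 2F)
  to-hub i 4F = step (side i 4F) (to-hub i 0F)

  connected : Connected RedCorners
  connected (i , a) (j , b) with i ≟ j
  ... | yes refl = to-hub i a ++ʷ reverseʷ reverse-edge (to-hub i b)
  ... | no  i≢j  = to-hub i a ++ʷ step (hub-edge i≢j) (reverseʷ reverse-edge (to-hub j b))

  redCopy : HasCopy red (𝒞 (mC5 m)) c
  redCopy = RedCorners , (connected , id , id , cycles-embed) , corner , corner-injective , λ _ _ → id

module _ {A : Set} where

  Unique-resp-⊇ : ∀ {xs ys : List A} → xs ⊆ ys → Unique ys → Unique xs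
  Unique-resp-⊇ []         u          = u
  Unique-resp-⊇ (_ ∷ʳ xs⊆) (_ ∷ u)    = Unique-resp-⊇ xs⊆ u
  Unique-resp-⊇ (refl ∷ xs⊆) (y∉ ∷ u) = All-resp-⊆ xs⊆ y∉ ∷ Unique-resp-⊇ xs⊆ u

  Unique-resp-↭ : ∀ {xs ys : List A} → xs ↭ ys → Unique xs → Unique ys
  Unique-resp-↭ xs↭ys = PermSetoid.Unique-resp-↭ (setoid A) (↭⇒↭ₛ xs↭ys)

  Unique-++-disjoint : ∀ xs {ys : List A} {x y} → Unique (xs ++ ys) → x ∈ xs → y ∈ ys → x ≢ y
  Unique-++-disjoint (_ ∷ xs) (x∉ ∷ _) (here refl) y∈ = All.lookup x∉ (∈-++⁺ʳ xs y∈)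
  Unique-++-disjoint (_ ∷ xs) (_ ∷ u)  (there x∈)  y∈ = Unique-++-disjoint xs u x∈ y∈

  lookup-injective : ∀ {xs : List A} → Unique xs → Injective _≡_ _≡_ (lookup xs)
  lookup-injective (_ ∷ _)  {zero}  {zero}  _  = refl
  lookup-injective (x∉ ∷ _) {zero}  {suc j} eq = contradiction eq (All.lookup x∉ (∈-lookup j))
  lookup-injective (x∉ ∷ _) {suc i} {zero}  eq = contradiction (sym eq) (All.lookup x∉ (∈-lookup i))
  lookup-injective (_ ∷ u)  {suc i} {suc j} eq = cong suc (lookup-injective u eq)

  record Enumeration (xs : List A) (L : ℕ) : Set where
    field
      entry     : Fin L → A
      injective : Injective _≡_ _≡_ entry
      member    : ∀ i → entry i ∈ xs

  enumerate : ∀ {xs : List A} {L} → Unique xs → L ≤ length xs → Enumeration xs L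
  enumerate {xs} u L≤ = record
    { entry     = λ i → lookup xs (inject≤ i L≤)
    ; injective = λ eq → inject≤-injective L≤ L≤ _ _ (lookup-injective u eq)
    ; member    = λ i → ∈-lookup _
    }

  extract : ∀ {x} {xs : List A} → x ∈ xs → ∃ λ ys → xs ↭ x ∷ ys
  extract x∈ with ys , zs , refl ← ∈-∃++ x∈ = ys ++ zs , shift _ ys zs

  extract₂ : ∀ {x y} {xs : List A} → x ∈ xs → y ∈ xs → x ≢ y → ∃ λ zs → xs ↭ x ∷ y ∷ zs
  extract₂ x∈ y∈ x≢y with extract x∈
  ... | ys , xs↭ with ∈-resp-↭ xs↭ y∈
  ...   | here y≡x   = contradiction (sym y≡x) x≢y
  ...   | there y∈ys with extract y∈ys
  ...     | zs , ys↭ = zs , ↭-trans xs↭ (prep _ ys↭)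

Good : ∀ {N} → Colouring N → List (Fin N) → Fin N → Set
Good c Q x = ∀ {u w} → u ∈ Q → w ∈ Q → u ≢ w → col c x u ≡ blue → col c x w ≡ blue → ⊥

RedClique : ∀ {N} → Colouring N → List (Fin N) → Set
RedClique c Q = ∀ {u w} → u ∈ Q → w ∈ Q → u ≢ w → col c u w ≡ red

Good-⊆ : ∀ {N} {c : Colouring N} {Q U x} → Q ⊆ U → Good c U x → Good c Q x
Good-⊆ Q⊆U good u∈ w∈ = good (Any-resp-⊆ Q⊆U u∈) (Any-resp-⊆ Q⊆U w∈)

clique-good : ∀ {N} {c : Colouring N} T {Q t} → Unique (T ++ Q) → RedClique c (T ++ Q) → t ∈ T → Good c Q t
clique-good T unique clique t∈ u∈ _ _ tu-blue _ =
  contradiction (trans (sym (clique (∈-++⁺ˡ t∈) (∈-++⁺ʳ T u∈) (Unique-++-disjoint T unique t∈ u∈))) tu-blue) λ ()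

redFromCentres : ∀ {N} (c : Colouring N) m (C Q : List (Fin N)) → Unique (C ++ Q) →
                 m ≤ length C → m * 4 ≤ length Q → RedClique c Q → All (Good c Q) C →
                 HasCopy red (𝒞 (mC5 m)) c
redFromCentres c m C Q unique enough-C enough-Q clique good =
  Pentagons.redCopy c m centre rim C.injective rim-inj centre≢rim rim-red centre-good
  where
  module C = Enumeration (enumerate (Unique-resp-⊇ (Sub.++⁺ʳ Q ⊆-refl) unique) enough-C)
  module Q = Enumeration (enumerate (Unique-resp-⊇ (Sub.++⁺ˡ C ⊆-refl) unique) enough-Q)

  centre : Fin m → Fin _
  centre = C.entry

  rim : Fin m × Fin 4 → Fin _
  rim (i , t) = Q.entry (combine i t)

  rim-inj : Injective _≡_ _≡_ rim
  rim-inj {i , t} {j , t′} eq with combine-injective i t j t′ (Q.injective eq)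
  ... | refl , refl = refl

  rim∈ : ∀ r → rim r ∈ Q
  rim∈ (i , t) = Q.member (combine i t)

  centre≢rim : ∀ i r → centre i ≢ rim r
  centre≢rim i r = Unique-++-disjoint C unique (C.member i) (rim∈ r)

  rim-red : ∀ r r′ → r ≢ r′ → col c (rim r) (rim r′) ≡ red
  rim-red r r′ r≢r′ = clique (rim∈ r) (rim∈ r′) (r≢r′ ∘ rim-inj)

  centre-good : ∀ i t t′ → t ≢ t′ → col c (centre i) (rim (i , t)) ≡ blue →
                col c (centre i) (rim (i , t′)) ≡ blue → ⊥
  centre-good i t t′ t≢t′ =
    All.lookup good (C.member i) (rim∈ (i , t)) (rim∈ (i , t′)) (t≢t′ ∘ cong proj₂ ∘ rim-inj)

-- Counting for the endgame: if k < n ≤ m and 2k + u = 5m + n − 1, then u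
-- vertices suffice for 4m rim vertices and m ∸ k extra centres.
leftover-bound : ∀ m n k u → k < n → n ≤ m → k + k + u ≡ 5 * m + n ∸ 1 → m * 4 + (m ∸ k) ≤ u
leftover-bound m (suc n) k u (s≤s k≤n) n<m total = +-cancelʳ-≤ (k + k) _ _ (begin
  m * 4 + (m ∸ k) + (k + k)  ≡⟨ regroup (m * 4) (m ∸ k) k ⟩
  m * 4 + ((m ∸ k) + k) + k  ≡⟨ cong (λ z → m * 4 + z + k) (m∸n+n≡m k≤m) ⟩
  m * 4 + m + k              ≤⟨ +-monoʳ-≤ (m * 4 + m) k≤n ⟩
  m * 4 + m + n              ≡⟨ regroup-5m m n ⟩
  n + m * 5                  ≡⟨ sym (bound-split m n) ⟩
  5 * m + suc n ∸ 1          ≡⟨ sym total ⟩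
  k + k + u                  ≡⟨ +-comm (k + k) u ⟩
  u + (k + k)                ∎)
  where
  open ≤-Reasoning
  open +-*-Solver

  k≤m : k ≤ m
  k≤m = ≤-trans k≤n (<⇒≤ n<m)

  regroup : ∀ x d k → x + d + (k + k) ≡ x + (d + k) + k
  regroup = solve 3 (λ x d k → x :+ d :+ (k :+ k) := x :+ (d :+ k) :+ k) refl

  regroup-5m : ∀ m n → m * 4 + m + n ≡ n + m * 5
  regroup-5m = solve 2 (λ m n → m :* con 4 :+ m :+ n := n :+ m :* con 5) refl

module Greedy {N} (c : Colouring N) where

  Edge : Set
  Edge = Fin N × Fin N

  BlueEdge : Edge → Set
  BlueEdge (a , b) = col c a b ≡ blue

  ends : List Edge → List (Fin N)
  ends []            = []
  ends ((a , b) ∷ M) = a ∷ b ∷ ends M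

  length-ends : ∀ M → length (ends M) ≡ length M + length M
  length-ends []      = refl
  length-ends (_ ∷ M) = cong suc (trans (cong suc (length-ends M)) (sym (+-suc (length M) (length M))))

  ends-↭ : ∀ {M M′} → M ↭ M′ → ends M ↭ ends M′
  ends-↭ ↭-refl                      = ↭-refl
  ends-↭ (prep (a , b) M↭)           = prep a (prep b (ends-↭ M↭))
  ends-↭ (swap (a , b) (a′ , b′) M↭) =
    ↭-trans (shifts (a ∷ b ∷ []) (a′ ∷ b′ ∷ [])) (prep a′ (prep b′ (prep a (prep b (ends-↭ M↭)))))
  ends-↭ (↭-trans M↭ M↭′)            = ↭-trans (ends-↭ M↭) (ends-↭ M↭′)

  BluePair : List (Fin N) → Fin N → Fin N → Set
  BluePair U a b = Any (λ u → Any (λ w → u ≢ w × col c a u ≡ blue × col c b w ≡ blue) U) U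

  bluePair? : ∀ U a b → Dec (BluePair U a b)
  bluePair? U a b = any? (λ u → any? (λ w → ¬? (u ≟ w) ×-dec (col c a u ≟ᶜ blue) ×-dec (col c b w ≟ᶜ blue)) U) U

  Augmenting : List (Fin N) → Edge → Set
  Augmenting U e = BluePair U (proj₁ e) (proj₂ e)

  BlueIn : List (Fin N) → Set
  BlueIn U = Any (λ u → Any (λ w → u ≢ w × col c u w ≡ blue) U) U

  blueIn? : ∀ U → Dec (BlueIn U)
  blueIn? U = any? (λ u → any? (λ w → ¬? (u ≟ w) ×-dec (col c u w ≟ᶜ blue)) U) U

  record State : Set where
    constructor state
    field
      matching  : List Edge
      unmatched : List (Fin N)
      partition : ends matching ++ unmatched ↭ allFin N
      all-blue  : All BlueEdge matching
  open State

  size : State → ℕ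
  size s = length (matching s)

  initial : State
  initial = state [] (allFin N) ↭-refl []

  state-unique : ∀ s → Unique (ends (matching s) ++ unmatched s)
  state-unique s = Unique-resp-↭ (↭-sym (partition s)) (allFin⁺ N)

  state-count : ∀ s → size s + size s + length (unmatched s) ≡ N
  state-count (state M U part _) = begin
    length M + length M + length U  ≡⟨ cong (_+ length U) (sym (length-ends M)) ⟩
    length (ends M) + length U      ≡⟨ sym (length-++ (ends M)) ⟩
    length (ends M ++ U)            ≡⟨ ↭-length part ⟩
    length (allFin N)               ≡⟨ length-tabulate id ⟩
    N                               ∎
    where open ≡-Reasoning

  Grown : State → Set
  Grown s = Σ State λ s′ → size s′ ≡ suc (size s)

  addEdge : ∀ s → BlueIn (unmatched s) → Grown s
  addEdge (state M U part blueM) blueIn =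
    let u , u∈ , ∃w            = find blueIn
        w , w∈ , u≢w , uw-blue = find ∃w
        U′ , U↭               = extract₂ u∈ w∈ u≢w
        moved = ↭-trans (Perm.++⁺ˡ (ends M) U↭) (shifts (ends M) (u ∷ w ∷ []))
    in state ((u , w) ∷ M) U′ (↭-trans (↭-sym moved) part) (uw-blue ∷ blueM) , refl

  augment : ∀ s → Any (Augmenting (unmatched s)) (matching s) → Grown s
  augment (state M U part blueM) augmenting =
    let (a , b) , ab∈ , pair     = find augmenting
        u , u∈ , ∃w              = find pair
        w , w∈ , u≢w , au , bw   = find ∃w
        U′ , U↭                 = extract₂ u∈ w∈ u≢w
        M′ , M↭                 = extract ab∈
        moved : ends M ++ U ↭ a ∷ u ∷ b ∷ w ∷ ends M′ ++ U′
        moved = ↭-trans (Perm.++⁺ʳ U (ends-↭ M↭))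
                (prep a (↭-trans (prep b (↭-trans (Perm.++⁺ˡ (ends M′) U↭) (shifts (ends M′) (u ∷ w ∷ []))))
                                 (swap b u ↭-refl)))
    in state ((a , u) ∷ (b , w) ∷ M′) U′ (↭-trans (↭-sym moved) part)
             (au ∷ bw ∷ All.tail (All-resp-↭ M↭ blueM)) ,
       cong suc (sym (↭-length M↭))

  Blocked : State → Set
  Blocked s = ¬ BlueIn (unmatched s) × ¬ Any (Augmenting (unmatched s)) (matching s)

  move : ∀ s → Grown s ⊎ Blocked s
  move s with blueIn? (unmatched s)
  ... | yes blueIn = inj₁ (addEdge s blueIn)
  ... | no  noBlue with any? (λ e → bluePair? (unmatched s) (proj₁ e) (proj₂ e)) (matching s)
  ...   | yes augmenting = inj₁ (augment s augmenting)
  ...   | no  noAug      = inj₂ (noBlue , noAug)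

  search : ∀ {n} fuel s → size s + fuel ≡ n →
           (Σ State λ s′ → size s′ ≡ n) ⊎ (Σ State λ s′ → Blocked s′ × size s′ < n)
  search zero s full = inj₁ (s , trans (sym (+-identityʳ (size s))) full)
  search (suc fuel) s total with move s
  ... | inj₁ (s′ , grew) = search fuel s′ (trans (cong (_+ fuel) grew) (trans (sym (+-suc (size s) fuel)) total))
  ... | inj₂ blocked     = inj₂ (s , blocked , subst (size s <_) total (m<m+n (size s) (s≤s z≤n)))

  label : (M : List Edge) → Fin (length M) × Fin 2 → Fin N
  label ((a , _) ∷ _) (0F , 0F)    = a
  label ((_ , b) ∷ _) (0F , 1F)    = b
  label (_ ∷ M)       (suc i , t) = label M (i , t)

  label-∈ : ∀ M x → label M x ∈ ends M
  label-∈ (_ ∷ _) (0F , 0F)    = here refl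
  label-∈ (_ ∷ _) (0F , 1F)    = there (here refl)
  label-∈ (_ ∷ M) (suc i , t) = there (there (label-∈ M (i , t)))

  label-injective : ∀ M → Unique (ends M) → Injective _≡_ _≡_ (label M)
  label-injective [] _ {() , _}
  label-injective ((a , b) ∷ M) ((a≢b ∷ a∉) ∷ b∉ ∷ u) = inj
    where
    inj : Injective _≡_ _≡_ (label ((a , b) ∷ M))
    inj {0F , 0F}    {0F , 0F}     _  = refl
    inj {0F , 1F}    {0F , 1F}     _  = refl
    inj {0F , 0F}    {0F , 1F}     eq = contradiction eq a≢b
    inj {0F , 1F}    {0F , 0F}     eq = contradiction (sym eq) a≢b
    inj {0F , 0F}    {suc j , t}   eq = contradiction eq (All.lookup a∉ (label-∈ M (j , t)))
    inj {0F , 1F}    {suc j , t}   eq = contradiction eq (All.lookup b∉ (label-∈ M (j , t)))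
    inj {suc i , t}  {0F , 0F}     eq = contradiction (sym eq) (All.lookup a∉ (label-∈ M (i , t)))
    inj {suc i , t}  {0F , 1F}     eq = contradiction (sym eq) (All.lookup b∉ (label-∈ M (i , t)))
    inj {suc i , t}  {suc j , t′}  eq = cong (map₁ suc) (label-injective M u eq)

  label-blue : ∀ M → All BlueEdge M → ∀ i → col c (label M (i , 0F)) (label M (i , 1F)) ≡ blue
  label-blue (_ ∷ _) (ab ∷ _)    zero    = ab
  label-blue (_ ∷ M) (_ ∷ blueM) (suc i) = label-blue M blueM i

  fullMatching : ∀ n s → size s ≡ n → HasCopy blue (Single (nK2 n)) c
  fullMatching _ s@(state M U _ blueM) refl =
    blueMatchingCopy c (length M) (label M)
      (label-injective M (Unique-resp-⊇ (Sub.++⁺ʳ U ⊆-refl) (state-unique s))) (label-blue M blueM)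

  noBlueIn⇒clique : ∀ {U} → ¬ BlueIn U → RedClique c U
  noBlueIn⇒clique noBlue u∈ w∈ u≢w = notBlue⇒red λ uw-blue → noBlue (lose u∈ (lose w∈ (u≢w , uw-blue)))

  lonely : ∀ {U a b u₁ u₂ u} → ¬ BluePair U a b → u₁ ∈ U → u₂ ∈ U → u₁ ≢ u₂ →
           col c a u₁ ≡ blue → col c a u₂ ≡ blue → u ∈ U → col c b u ≢ blue
  lonely {u₁ = u₁} {u = u} noAug u₁∈ u₂∈ u₁≢u₂ au₁ au₂ u∈ bu with u ≟ u₁
  ... | yes refl = noAug (lose u₂∈ (lose u∈ (u₁≢u₂ ∘ sym , au₂ , bu)))
  ... | no  u≢u₁ = noAug (lose u₁∈ (lose u∈ (u≢u₁ ∘ sym , au₁ , bu)))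

  goodEnd : ∀ U a b → ¬ BluePair U a b → Good c U a ⊎ Good c U b
  goodEnd U a b noAug with bluePair? U a a
  ... | no  noTwo = inj₁ λ u∈ w∈ u≢w au aw → noTwo (lose u∈ (lose w∈ (u≢w , au , aw)))
  ... | yes two =
    let u₁ , u₁∈ , ∃u₂            = find two
        u₂ , u₂∈ , u₁≢u₂ , au₁ , au₂ = find ∃u₂
    in inj₂ λ u∈ _ _ bu _ → lonely noAug u₁∈ u₂∈ u₁≢u₂ au₁ au₂ u∈ bu

  record GoodEnds (U : List (Fin N)) (M : List Edge) : Set where
    constructor goodEnds
    field
      chosen  : List (Fin N)
      chosen⊆ : chosen ⊆ ends M
      count   : length chosen ≡ length M
      good    : All (Good c U) chosen

  chooseEnds : ∀ U M → ¬ Any (Augmenting U) M → GoodEnds U M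
  chooseEnds U [] _ = goodEnds [] [] refl []
  chooseEnds U ((a , b) ∷ M) noAug with chooseEnds U M (noAug ∘ there) | goodEnd U a b (noAug ∘ here)
  ... | goodEnds X X⊆ len good | inj₁ a-good = goodEnds (a ∷ X) (refl ∷ (b ∷ʳ X⊆)) (cong suc len) (a-good ∷ good)
  ... | goodEnds X X⊆ len good | inj₂ b-good = goodEnds (b ∷ X) (a ∷ʳ (refl ∷ X⊆)) (cong suc len) (b-good ∷ good)

  -- A blocked state with k < n ≤ m matching edges on 5m + n − 1 vertices
  -- yields a red 𝒞(mC₅): the chosen ends and m ∸ k unmatched vertices are
  -- the centres, the remaining unmatched vertices form the rim clique.
  blockedRed : ∀ m n → n ≤ m → N ≡ 5 * m + n ∸ 1 → ∀ s → Blocked s → size s < n →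
               HasCopy red (𝒞 (mC5 m)) c
  blockedRed m n n≤m N≡ s@(state M U _ _) (noBlue , noAug) k<n =
    redFromCentres c m (X ++ T) Q unique-centres enough-centres enough-rim rim-clique centres-good
    where
    open GoodEnds (chooseEnds U M noAug) renaming (chosen to X)
    k d : ℕ
    k = length M
    d = m ∸ k

    T Q : List (Fin N)
    T = take d U
    Q = drop d U

    clique : RedClique c U
    clique = noBlueIn⇒clique noBlue

    split : T ++ Q ≡ U
    split = take++drop≡id d U

    unique-U : Unique U
    unique-U = Unique-resp-⊇ (Sub.++⁺ˡ (ends M) ⊆-refl) (state-unique s)

    unique-centres : Unique ((X ++ T) ++ Q)
    unique-centres = subst Unique (sym (trans (++-assoc X T Q) (cong (X ++_) split)))
                       (Unique-resp-⊇ (Sub.++⁺ chosen⊆ ⊆-refl) (state-unique s))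

    bound : m * 4 + d ≤ length U
    bound = leftover-bound m n k (length U) k<n n≤m (trans (state-count s) N≡)

    enough-centres : m ≤ length (X ++ T)
    enough-centres = subst (m ≤_) (sym centres-count) (m≤n+m∸n m k)
      where
      centres-count : length (X ++ T) ≡ k + d
      centres-count = trans (length-++ X)
        (cong₂ _+_ count (trans (length-take d U) (m≤n⇒m⊓n≡m (m+n≤o⇒n≤o (m * 4) bound))))

    enough-rim : m * 4 ≤ length Q
    enough-rim = subst (m * 4 ≤_) (sym (length-drop d U)) (m+n≤o⇒m≤o∸n (m * 4) bound)

    rim-clique : RedClique c Q
    rim-clique u∈ w∈ = clique (Any-resp-⊆ (drop-⊆ d U) u∈) (Any-resp-⊆ (drop-⊆ d U) w∈)

    centres-good : All (Good c Q) (X ++ T)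
    centres-good = AllP.++⁺ (All.map (Good-⊆ {c = c} (drop-⊆ d U)) good)
      (All.tabulate (clique-good {c = c} T (subst Unique (sym split) unique-U)
                                           (subst (RedClique c) (sym split) clique)))

upperBound : ∀ m n → n ≤ m → Arrows (5 * m + n ∸ 1) (𝒞 (mC5 m)) (Single (nK2 n))
upperBound m n n≤m c with Greedy.search c n (Greedy.initial c) refl
... | inj₁ (s , full)            = inj₂ (Greedy.fullMatching c n s full)
... | inj₂ (s , blocked , short) = inj₁ (Greedy.blockedRed c m n n≤m refl s blocked short)

lemma4p9 : (m n : ℕ) → 1 ≤ n → n ≤ m →
    RamseyIs (𝒞 (mC5 m)) (Single (nK2 n)) (5 * m + n ∸ 1)
lemma4p9 m n 1≤n n≤m = upperBound m n n≤m , lowerBound m n 1≤n n≤m
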